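{- Let $T_1,\dots,T_k$ be tree presentations and $T=\sigma(T_1,\dots,T_k)$. Then $\mathrm{Aut}(\mathcal{L}^*_T)\cong H_k\ltimes G$, where $$G=\prod_{q\in\mathbb{Q}_{[k]}}\mathrm{Aut}(\mathcal{L}^*_{T_{\#(q)}})\cong\big(\mathrm{Aut}(\mathcal{L}^*_{T_1})\times\cdots\times\mathrm{Aut}(\mathcal{L}^*_{T_k})\big)^\omega,$$ $H_k$ is the group of all order automorphisms of $\mathbb{Q}_{[k]}=\mathbb{Q}_1\cup\cdots\cup\mathbb{Q}_k$ that preserve each $\mathbb{Q}_i$ ($1\le i\le k$) setwise, and $H_k$ acts on $G$ by permuting the index set $\mathbb{Q}_{[k]}$.
   Context: Tree presentations are finite trees whose nodes are finite sequences of positive integers, each node labelled $\ell$ (leaf), $s$ (sum) or $\sigma$ (shuffle), defined inductively: $1$ is the tree consisting only of the root $\langle\rangle$, labelled $\ell$; if $T_1,\dots,T_k$ ($k\ge1$) are tree presentations then $s(T_1,\dots,T_k)$ (resp. $\sigma(T_1,\dots,T_k)$) is the tree whose nodes are the root $\langle\rangle$, labelled $s$ (resp. $\sigma$), together with the nodes $\langle i\rangle^\frown t$ for $1\le i\le k$ and $t\in T_i$, labelled as $t$ is in $T_i$. For a sequence $u$ and $i\le|u|$, $u\upharpoonright i$ is its initial segment of length $i$. Fix once and for all a partition $\langle\mathbb{Q}_n\rangle_{n\ge1}$ of $\mathbb{Q}$ into sets each dense in $\mathbb{Q}$, with $n\in\mathbb{Q}_n$. For $q\in\mathbb{Q}$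 let $\#(q)$ be the $n$ with $q\in\mathbb{Q}_n$; for $\bar r=\langle r_0,\dots,r_{m-1}\rangle$ let $\#(\bar r)=\langle\#(r_0),\dots,\#(r_{m-1})\rangle$. For a tree presentation $T$, $\mathcal{L}_T$ is the set of finite sequences $\bar r$ of rationals such that $\#(\bar r)$ is a leaf of $T$ and for each $i<|\bar r|$, if $\#(\bar r)\upharpoonright i$ is a sum node then $r_i=\#(r_i)$, ordered lexicographically. For a node $t$, $D_t$ is the set of $\bar r\in\mathcal{L}_T$ such that $\#(\bar r)$ extends $t$. $\mathcal{L}^*_T$ is the expansion of $(\mathcal{L}_T,<)$ by binary relations $E_t$ ($t\in T$), where $\bar r\,E_t\,\bar s$ iff $\bar r,\bar s\in D_t$ and $\bar r\upharpoonright|t|=\bar s\upharpoonright|t|$. -}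

module Defs where

open import Data.Nat as ℕ using (ℕ; zero; suc; _∸_; _<?_)
open import Data.Nat.Properties using (∸-monoˡ-≤)
open import Data.Integer using (+_)
open import Data.Rational using (ℚ; _/_) renaming (_<_ to _<ℚ_)
open import Data.Fin using (Fin; toℕ; fromℕ<)
open import Data.List using (List; []; _∷_; map; take; length; lookup)
open import Data.Maybe using (Maybe; just; nothing)
open import Data.Product using (Σ; ∃; _×_; _,_; proj₁; proj₂)
open import Relation.Nullary using (yes; no)
open import Relation.Binary.PropositionalEquality using (_≡_; refl; sym; trans; cong)
open import Algebra.Bundles.Raw using (RawGroup)
open import Level using (0ℓ)

-- Tree presentations.
-- `σ k Ts` / `s k Ts` have the k+1 children Ts 0, ..., Ts k
-- (so the paper's s(T_1,...,T_m), m ≥ 1, is `s (m ∸ 1) (λ i → T_(i+1))`).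

data TP : Set where
  𝟙 : TP
  s : (k : ℕ) → (Fin (suc k) → TP) → TP
  σ : (k : ℕ) → (Fin (suc k) → TP) → TP

data Label : Set where
  ℓ-leaf s-sum σ-shuffle : Label

-- Nodes are finite sequences of positive integers; child i (1 ≤ i ≤ k+1)
-- of a node t is t ⌢ ⟨i⟩.  `label T t` is `just` the label of t if t is a
-- node of T and `nothing` otherwise.
childAt : (k : ℕ) → (Fin (suc k) → TP) → ℕ → Maybe TP
childAt k Ts zero = nothing
childAt k Ts (suc j) with j <? suc k
... | yes p = just (Ts (fromℕ< p))
... | no _  = nothing

label : TP → List ℕ → Maybe Label
label 𝟙 [] = just ℓ-leaf
label 𝟙 (_ ∷ _) = nothing
label (s k Ts) [] = just s-sum
label (s k Ts) (i ∷ t) = labelIn (childAt k Ts i) t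
  where
  labelIn : Maybe TP → List ℕ → Maybe Label
  labelIn nothing  _ = nothing
  labelIn (just T') u = label T' u
label (σ k Ts) [] = just σ-shuffle
label (σ k Ts) (i ∷ t) = labelIn (childAt k Ts i) t
  where
  labelIn : Maybe TP → List ℕ → Maybe Label
  labelIn nothing  _ = nothing
  labelIn (just T') u = label T' u

IsNode : TP → List ℕ → Set
IsNode T t = ∃ λ l → label T t ≡ just l

-- A partition ⟨ℚ_n⟩_{n ≥ 1} of ℚ into dense sets with n ∈ ℚ_n,
-- given through #(q) = the n with q ∈ ℚ_n.

ℕ→ℚ : ℕ → ℚ
ℕ→ℚ n = + n / 1

record Partition : Set where
  field
    # : ℚ → ℕ
    #-pos : ∀ q → 1 ℕ.≤ # q
    #-self : ∀ n → 1 ℕ.≤ n → # (ℕ→ℚ n) ≡ n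
    dense : ∀ n → 1 ℕ.≤ n → ∀ a b → a <ℚ b →
            ∃ λ q → (a <ℚ q) × (q <ℚ b) × (# q ≡ n)

data _<lex_ : List ℚ → List ℚ → Set where
  []<∷ : ∀ {y ys} → [] <lex (y ∷ ys)
  head< : ∀ {x y xs ys} → x <ℚ y → (x ∷ xs) <lex (y ∷ ys)
  tail< : ∀ {x y xs ys} → x ≡ y → xs <lex ys → (x ∷ xs) <lex (y ∷ ys)

data _⊑_ : List ℕ → List ℕ → Set where
  []⊑ : ∀ {v} → [] ⊑ v
  ∷⊑  : ∀ {x u v} → u ⊑ v → (x ∷ u) ⊑ (x ∷ v)

module _ (P : Partition) where
  open Partition P

  #̄ : List ℚ → List ℕ
  #̄ = map #

  InL : TP → List ℚ → Set
  InL T r = (label T (#̄ r) ≡ just ℓ-leaf)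
          × (∀ (i : Fin (length r)) → label T (take (toℕ i) (#̄ r)) ≡ just s-sum →
               lookup r i ≡ ℕ→ℚ (# (lookup r i)))

  record Elem (T : TP) : Set where
    constructor elem
    field
      seq : List ℚ
      inL : InL T seq
  open Elem

  module _ {T : TP} where
    _≈E_ : Elem T → Elem T → Set
    x ≈E y = seq x ≡ seq y

    _<E_ : Elem T → Elem T → Set
    x <E y = seq x <lex seq y

    D : List ℕ → Elem T → Set
    D t x = t ⊑ #̄ (seq x)

    E : List ℕ → Elem T → Elem T → Set
    E t x y = D t x × D t y × (take (length t) (seq x) ≡ take (length t) (seq y))

  record Aut (T : TP) : Set where
    field
      to from : Elem T → Elem T
      to-cong : ∀ {x y} → x ≈E y → to x ≈E to y
      from-cong : ∀ {x y} → x ≈E y → from x ≈E from y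
      to-from : ∀ x → to (from x) ≈E x
      from-to : ∀ x → from (to x) ≈E x
      to-< : ∀ {x y} → x <E y → to x <E to y
      from-< : ∀ {x y} → x <E y → from x <E from y
      to-E : ∀ t → IsNode T t → ∀ {x y} → E t x y → E t (to x) (to y)
      from-E : ∀ t → IsNode T t → ∀ {x y} → E t x y → E t (from x) (from y)
  open Aut

  module _ {T : TP} where
    _≈A_ : Aut T → Aut T → Set
    f ≈A g = ∀ x → to f x ≈E to g x

    _∘A_ : Aut T → Aut T → Aut T
    f ∘A g = record
      { to = λ x → to f (to g x)
      ; from = λ x → from g (from f x)
      ; to-cong = λ e → to-cong f (to-cong g e)
      ; from-cong = λ e → from-cong g (from-cong f e)
      ; to-from = λ x → trans (to-cong f (to-from g (from f x))) (to-from f x)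
      ; from-to = λ x → trans (from-cong g (from-to f (to g x))) (from-to g x)
      ; to-< = λ p → to-< f (to-< g p)
      ; from-< = λ p → from-< g (from-< f p)
      ; to-E = λ t n p → to-E f t n (to-E g t n p)
      ; from-E = λ t n p → from-E g t n (from-E f t n p)
      }

    idA : Aut T
    idA = record
      { to = λ x → x ; from = λ x → x
      ; to-cong = λ e → e ; from-cong = λ e → e
      ; to-from = λ _ → refl ; from-to = λ _ → refl
      ; to-< = λ p → p ; from-< = λ p → p
      ; to-E = λ _ _ p → p ; from-E = λ _ _ p → p
      }

    invA : Aut T → Aut T
    invA f = record
      { to = from f ; from = to f
      ; to-cong = from-cong f ; from-cong = to-cong f
      ; to-from = from-to f ; from-to = to-from f
      ; to-< = from-< f ; from-< = to-< f
      ; to-E = from-E f ; from-E = to-E f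
      }

  AutGroup : TP → RawGroup 0ℓ 0ℓ
  AutGroup T = record
    { Carrier = Aut T ; _≈_ = _≈A_ ; _∙_ = _∘A_ ; ε = idA ; _⁻¹ = invA }

  QK : ℕ → Set
  QK K = Σ ℚ (λ q → # q ℕ.≤ K)

  record H (K : ℕ) : Set where
    field
      to from : QK K → QK K
      to-cong : ∀ {x y} → proj₁ x ≡ proj₁ y → proj₁ (to x) ≡ proj₁ (to y)
      from-cong : ∀ {x y} → proj₁ x ≡ proj₁ y → proj₁ (from x) ≡ proj₁ (from y)
      to-from : ∀ x → proj₁ (to (from x)) ≡ proj₁ x
      from-to : ∀ x → proj₁ (from (to x)) ≡ proj₁ x
      to-< : ∀ {x y} → proj₁ x <ℚ proj₁ y → proj₁ (to x) <ℚ proj₁ (to y)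
      from-< : ∀ {x y} → proj₁ x <ℚ proj₁ y → proj₁ (from x) <ℚ proj₁ (from y)
      to-# : ∀ x → # (proj₁ (to x)) ≡ # (proj₁ x)
      from-# : ∀ x → # (proj₁ (from x)) ≡ # (proj₁ x)

  module _ {K : ℕ} where
    private module Hm = H
    _≈H_ : H K → H K → Set
    h ≈H h' = ∀ x → proj₁ (Hm.to h x) ≡ proj₁ (Hm.to h' x)

    _∘H_ : H K → H K → H K
    h ∘H h' = record
      { to = λ x → Hm.to h (Hm.to h' x)
      ; from = λ x → Hm.from h' (Hm.from h x)
      ; to-cong = λ e → Hm.to-cong h (Hm.to-cong h' e)
      ; from-cong = λ e → Hm.from-cong h' (Hm.from-cong h e)
      ; to-from = λ x → trans (Hm.to-cong h (Hm.to-from h' (Hm.from h x))) (Hm.to-from h x)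
      ; from-to = λ x → trans (Hm.from-cong h' (Hm.from-to h (Hm.to h' x))) (Hm.from-to h' x)
      ; to-< = λ p → Hm.to-< h (Hm.to-< h' p)
      ; from-< = λ p → Hm.from-< h' (Hm.from-< h p)
      ; to-# = λ x → trans (Hm.to-# h (Hm.to h' x)) (Hm.to-# h' x)
      ; from-# = λ x → trans (Hm.from-# h' (Hm.from h x)) (Hm.from-# h x)
      }

    idH : H K
    idH = record
      { to = λ x → x ; from = λ x → x
      ; to-cong = λ e → e ; from-cong = λ e → e
      ; to-from = λ _ → refl ; from-to = λ _ → refl
      ; to-< = λ p → p ; from-< = λ p → p
      ; to-# = λ _ → refl ; from-# = λ _ → refl
      }

    invH : H K → H K
    invH h = record
      { to = Hm.from h ; from = Hm.to h
      ; to-cong = Hm.from-cong h ; from-cong = Hm.to-cong h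
      ; to-from = Hm.from-to h ; from-to = Hm.to-from h
      ; to-< = Hm.from-< h ; from-< = Hm.to-< h
      ; to-# = Hm.from-# h ; from-# = Hm.to-# h
      }

  -- G = ∏_{q ∈ ℚ_[k+1]} Aut(𝓛*_{T_#(q)}).  The factor at q is indexed by
  -- i : Fin (suc k) together with a witness #(q) = i + 1 (the paper's T_#(q)
  -- is Ts i for this i).

  module _ (k : ℕ) (Ts : Fin (suc k) → TP) where

    GElem : Set
    GElem = (q : QK (suc k)) (i : Fin (suc k)) → # (proj₁ q) ≡ suc (toℕ i) → Aut (Ts i)

    _≈G_ : GElem → GElem → Set
    g ≈G g' = ∀ q i e → g q i e ≈A g' q i e

    _·G_ : GElem → GElem → GElem
    (g ·G g') q i e = g q i e ∘A g' q i e

    1G : GElem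
    1G q i e = idA

    invG : GElem → GElem
    invG g q i e = invA (g q i e)

    _▹_ : H (suc k) → GElem → GElem
    (h ▹ g) q i e = g (H.from h q) i (trans (H.from-# h q) e)

    GGroup : RawGroup 0ℓ 0ℓ
    GGroup = record
      { Carrier = GElem ; _≈_ = _≈G_ ; _∙_ = _·G_ ; ε = 1G ; _⁻¹ = invG }

    SemidirectGroup : RawGroup 0ℓ 0ℓ
    SemidirectGroup = record
      { Carrier = GElem × H (suc k)
      ; _≈_ = λ x y → (proj₁ x ≈G proj₁ y) × (proj₂ x ≈H proj₂ y)
      ; _∙_ = λ x y → (proj₁ x ·G (proj₂ x ▹ proj₁ y)) , (proj₂ x ∘H proj₂ y)
      ; ε = 1G , idH
      ; _⁻¹ = λ x → (invH (proj₂ x) ▹ invG (proj₁ x)) , invH (proj₂ x)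
      }

    PowGroup : RawGroup 0ℓ 0ℓ
    PowGroup = record
      { Carrier = ℕ → (i : Fin (suc k)) → Aut (Ts i)
      ; _≈_ = λ g g' → ∀ n i → g n i ≈A g' n i
      ; _∙_ = λ g g' n i → g n i ∘A g' n i
      ; ε = λ _ _ → idA
      ; _⁻¹ = λ g n i → invA (g n i)
      }

open import Algebra.Morphism.Structures using (module GroupMorphisms)

_≅_ : RawGroup 0ℓ 0ℓ → RawGroup 0ℓ 0ℓ → Set
G₁ ≅ G₂ = ∃ λ (φ : RawGroup.Carrier G₁ → RawGroup.Carrier G₂) →
            GroupMorphisms.IsGroupIsomorphism G₁ G₂ φ

-- An automorphism f of 𝓛*_σ(T₁,…,T_k) preserves every E_⟨n⟩, whose classes are the sets of
-- sequences with a fixed first entry q ∈ ℚ_n. So f permutes first entries by some h ∈ H_k, and,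
-- preserving < and the E_t below ⟨n⟩ as well, it maps the block q ∷ 𝓛_{T_n} onto h(q) ∷ 𝓛_{T_n}
-- by an automorphism g_{h(q)} of 𝓛*_{T_n}. Conversely every pair (g , h) acts by
-- q ∷ r ↦ h(q) ∷ g_{h(q)}(r), and f ↦ (g , h) is an isomorphism onto H_k ⋉ G.
-- Each ℚ_n is infinite by density and a decidable subset of the effectively countable ℚ, so it
-- can be enumerated without repetition; reindexing G along these enumerations gives G ≅ (∏ᵢ Aut)^ω.

module Submission where

open import Defs
open import Algebra.Bundles.Raw using (RawGroup)
open import Data.Fin using (Fin; toℕ; fromℕ<) renaming (zero to fzero; suc to fsuc)
open import Data.Fin.Properties using (toℕ<n; toℕ-injective; fromℕ<-toℕ; toℕ-fromℕ<)
open import Data.Integer using (ℤ; +_; -[1+_])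
open import Data.List using (List; []; _∷_; take; length; lookup)
open import Data.List.Properties using (∷-injective)
open import Data.Maybe using (just)
open import Data.Nat as ℕ using (ℕ; zero; suc; _+_; _∸_; _≤_; _<_; z≤n; s≤s; _≤?_; _<?_)
import Data.Nat.Properties as ℕ
open import Data.Product using (∃; _×_; _,_; proj₁; proj₂)
open import Data.Rational as ℚ using (ℚ; 0ℚ; 1ℚ; _/_; ↥_)
  renaming (_<_ to _<ℚ_; _≤_ to _≤ℚ_; _+_ to _+ℚ_; _⊔_ to _⊔ℚ_)
import Data.Rational.Properties as ℚ
open import Data.Sum using (_⊎_; inj₁; inj₂)
open import Function using (_∘_)
open import Relation.Nullary using (yes; no; ¬_)
open import Relation.Nullary.Decidable using (_×-dec_)
open import Relation.Nullary.Negation using (contradiction)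
open import Relation.Unary using (Decidable)
open import Relation.Binary.PropositionalEquality
  using (_≡_; refl; sym; trans; cong; cong₂; subst; subst₂; module ≡-Reasoning)

Unbounded : (ℕ → Set) → Set
Unbounded S = ∀ N → ∃ λ j → N ≤ j × S j

module Enumeration {S : ℕ → Set} (S? : Decidable S) (unbounded : Unbounded S) where

  record IsLeastFrom (N r : ℕ) : Set where
    field
      lower : N ≤ r
      member : S r
      gap : ∀ j → N ≤ j → j < r → ¬ S j
  open IsLeastFrom
  open ≡-Reasoning

  least-here : ∀ {N} → S N → IsLeastFrom N N
  least-here sN = record
    { lower = ℕ.≤-refl ; member = sN ; gap = λ j N≤j j<N → contradiction j<N (ℕ.≤⇒≯ N≤j) }

  least-step : ∀ {N r} → ¬ S N → IsLeastFrom (suc N) r → IsLeastFrom N r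
  least-step {N} {r} ¬sN l = record { lower = ℕ.<⇒≤ (lower l) ; member = member l ; gap = gap′ }
    where
    gap′ : ∀ j → N ≤ j → j < r → ¬ S j
    gap′ j N≤j j<r with ℕ.m≤n⇒m<n∨m≡n N≤j
    ... | inj₁ N<j = gap l j N<j j<r
    ... | inj₂ refl = ¬sN

  search : ℕ → ℕ → ℕ
  search N zero = N
  search N (suc fuel) with S? N
  ... | yes _ = N
  ... | no _ = search (suc N) fuel

  search-least : ∀ N fuel → S (N + fuel) → IsLeastFrom N (search N fuel)
  search-least N zero sN+0 rewrite ℕ.+-identityʳ N = least-here sN+0
  search-least N (suc fuel) sN+f with S? N
  ... | yes sN = least-here sN
  ... | no ¬sN = least-step ¬sN (search-least (suc N) fuel (subst S (ℕ.+-suc N fuel) sN+f))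

  leastFrom : ℕ → ℕ
  leastFrom N = search N (proj₁ (unbounded N) ∸ N)

  leastFrom-least : ∀ N → IsLeastFrom N (leastFrom N)
  leastFrom-least N with unbounded N
  ... | j , N≤j , sj = search-least N (j ∸ N) (subst S (sym (ℕ.m+[n∸m]≡n N≤j)) sj)

  enum : ℕ → ℕ
  enum zero = leastFrom zero
  enum (suc n) = leastFrom (suc (enum n))

  rank : ℕ → ℕ
  rank zero = zero
  rank (suc j) with S? j
  ... | yes _ = suc (rank j)
  ... | no _ = rank j

  rank-gap : ∀ {N r} → (∀ j → N ≤ j → j < r → ¬ S j) → N ≤ r → rank r ≡ rank N
  rank-gap {r = zero} gap z≤n = refl
  rank-gap {N} {suc r} gap N≤r with ℕ.m≤n⇒m<n∨m≡n N≤r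
  ... | inj₂ refl = refl
  ... | inj₁ (s≤s N≤r′) with S? r
  ...   | yes sr = contradiction sr (gap r N≤r′ ℕ.≤-refl)
  ...   | no _ = rank-gap (λ j N≤j j<r → gap j N≤j (ℕ.m<n⇒m<1+n j<r)) N≤r′

  rank-suc : ∀ {j} → S j → rank (suc j) ≡ suc (rank j)
  rank-suc {j} sj with S? j
  ... | yes _ = refl
  ... | no ¬sj = contradiction sj ¬sj

  enum∈S : ∀ n → S (enum n)
  enum∈S zero = member (leastFrom-least zero)
  enum∈S (suc n) = member (leastFrom-least (suc (enum n)))

  rank-enum : ∀ n → rank (enum n) ≡ n
  rank-enum zero = rank-gap (gap l) (lower l) where l = leastFrom-least zero
  rank-enum (suc n) = begin
    rank (enum (suc n))   ≡⟨ rank-gap (gap l) (lower l) ⟩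
    rank (suc (enum n))   ≡⟨ rank-suc (enum∈S n) ⟩
    suc (rank (enum n))   ≡⟨ cong suc (rank-enum n) ⟩
    suc n                 ∎
    where l = leastFrom-least (suc (enum n))

  n≤enum : ∀ n → n ≤ enum n
  n≤enum zero = z≤n
  n≤enum (suc n) = ℕ.≤-trans (s≤s (n≤enum n)) (lower (leastFrom-least (suc (enum n))))

  enum-covers : ∀ n {j} → S j → j ≤ enum n → ∃ λ n′ → enum n′ ≡ j
  enum-covers zero {j} sj j≤ with ℕ.m≤n⇒m<n∨m≡n j≤
  ... | inj₁ j< = contradiction sj (gap (leastFrom-least zero) j z≤n j<)
  ... | inj₂ refl = zero , refl
  enum-covers (suc n) {j} sj j≤ with j ≤? enum n
  ... | yes j≤′ = enum-covers n sj j≤′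
  ... | no j≰ with ℕ.m≤n⇒m<n∨m≡n j≤
  ...   | inj₁ j< = contradiction sj (gap (leastFrom-least (suc (enum n))) j (ℕ.≰⇒> j≰) j<)
  ...   | inj₂ refl = suc n , refl

  enum-rank : ∀ {j} → S j → enum (rank j) ≡ j
  enum-rank {j} sj with enum-covers j sj (n≤enum j)
  ... | n , refl = cong enum (rank-enum n)

-- the successor in the Cantor enumeration of ℕ × ℕ, walking the antidiagonals
next-pair : ℕ × ℕ → ℕ × ℕ
next-pair (a , zero) = (0 , suc a)
next-pair (a , suc b) = (suc a , b)

unpair : ℕ → ℕ × ℕ
unpair zero = (0 , 0)
unpair (suc n) = next-pair (unpair n)

triangle : ℕ → ℕ
triangle zero = 0
triangle (suc n) = triangle n + suc n

pair : ℕ → ℕ → ℕ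
pair a b = triangle (a + b) + a

unpair-triangle+ : ∀ d a b → a + b ≡ d → unpair (triangle d + a) ≡ (a , b)
unpair-triangle+ zero zero zero refl = refl
unpair-triangle+ (suc d) zero b refl
  rewrite ℕ.+-identityʳ (triangle d + suc d) | ℕ.+-suc (triangle d) d
        | unpair-triangle+ d d 0 (ℕ.+-identityʳ d) = refl
unpair-triangle+ d (suc a) b a+b≡d
  rewrite ℕ.+-suc (triangle d) a | unpair-triangle+ d a (suc b) (trans (ℕ.+-suc a b) a+b≡d) = refl

unpair-pair : ∀ a b → unpair (pair a b) ≡ (a , b)
unpair-pair a b = unpair-triangle+ (a + b) a b refl

encodeℤ : ℤ → ℕ
encodeℤ (+ n) = pair 0 n
encodeℤ -[1+ n ] = pair 1 n

decodeℤ : ℕ → ℤ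
decodeℤ j with unpair j
... | zero , n = + n
... | suc _ , n = -[1+ n ]

decodeℤ-encodeℤ : ∀ z → decodeℤ (encodeℤ z) ≡ z
decodeℤ-encodeℤ (+ n) rewrite unpair-pair 0 n = refl
decodeℤ-encodeℤ -[1+ n ] rewrite unpair-pair 1 n = refl

encodeℚ : ℚ → ℕ
encodeℚ q = pair (encodeℤ (↥ q)) (ℚ.denominator-1 q)

decodeℚ : ℕ → ℚ
decodeℚ j with unpair j
... | a , d = decodeℤ a / suc d

decodeℚ-encodeℚ : ∀ q → decodeℚ (encodeℚ q) ≡ q
decodeℚ-encodeℚ q
  rewrite unpair-pair (encodeℤ (↥ q)) (ℚ.denominator-1 q) | decodeℤ-encodeℤ (↥ q) = ℚ.↥p/↧p≡p q

p<p+1 : ∀ p → p <ℚ p +ℚ 1ℚ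
p<p+1 p = subst (_<ℚ p +ℚ 1ℚ) (ℚ.+-identityʳ p) (ℚ.+-monoʳ-< p (ℚ.positive⁻¹ 1ℚ))

maxUpTo : (ℕ → ℚ) → ℕ → ℚ
maxUpTo f zero = f zero
maxUpTo f (suc N) = maxUpTo f N ⊔ℚ f (suc N)

≤-maxUpTo : ∀ f {i N} → i ≤ N → f i ≤ℚ maxUpTo f N
≤-maxUpTo f {N = zero} z≤n = ℚ.≤-refl
≤-maxUpTo f {i} {suc N} i≤1+N with ℕ.m≤n⇒m<n∨m≡n i≤1+N
... | inj₁ (s≤s i≤N) = ℚ.p≤q⇒p≤q⊔r (f (suc N)) (≤-maxUpTo f i≤N)
... | inj₂ refl = ℚ.p≤q⊔p (maxUpTo f N) (f (suc N))

module Stratum (P : Partition) (m : ℕ) (1≤m : 1 ≤ m) where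
  open Partition P

  -- the second conjunct keeps only canonical codes, so that each q ∈ ℚ_m is counted once
  IsCode : ℕ → Set
  IsCode j = # (decodeℚ j) ≡ m × encodeℚ (decodeℚ j) ≡ j

  isCode? : Decidable IsCode
  isCode? j = (# (decodeℚ j) ℕ.≟ m) ×-dec (encodeℚ (decodeℚ j) ℕ.≟ j)

  isCode-encodeℚ : ∀ {q} → # q ≡ m → IsCode (encodeℚ q)
  isCode-encodeℚ {q} #q≡m rewrite decodeℚ-encodeℚ q = #q≡m , refl

  -- a point of ℚ_m above decodeℚ 0, …, decodeℚ N has a code larger than N
  isCode-unbounded : Unbounded IsCode
  isCode-unbounded N = above (dense m 1≤m B (B +ℚ 1ℚ) (p<p+1 B))
    where
    B = maxUpTo decodeℚ N
    above : (∃ λ q → B <ℚ q × q <ℚ B +ℚ 1ℚ × # q ≡ m) → ∃ λ j → N ≤ j × IsCode j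
    above (q , B<q , _ , #q≡m) = encodeℚ q , N≤code , isCode-encodeℚ #q≡m
      where
      q≤B : encodeℚ q ≤ N → q ≤ℚ B
      q≤B code≤N = subst (_≤ℚ B) (decodeℚ-encodeℚ q) (≤-maxUpTo decodeℚ code≤N)
      N≤code : N ≤ encodeℚ q
      N≤code = ℕ.≮⇒≥ λ code<N → ℚ.<-irrefl refl (ℚ.<-≤-trans B<q (q≤B (ℕ.<⇒≤ code<N)))

  open Enumeration isCode? isCode-unbounded using (enum; rank; enum∈S; rank-enum; enum-rank)

  enumℚ : ℕ → ℚ
  enumℚ n = decodeℚ (enum n)

  indexℚ : ℚ → ℕ
  indexℚ q = rank (encodeℚ q)

  #-enumℚ : ∀ n → # (enumℚ n) ≡ m
  #-enumℚ n = proj₁ (enum∈S n)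

  enumℚ-indexℚ : ∀ {q} → # q ≡ m → enumℚ (indexℚ q) ≡ q
  enumℚ-indexℚ {q} #q≡m = trans (cong decodeℚ (enum-rank (isCode-encodeℚ #q≡m))) (decodeℚ-encodeℚ q)

  indexℚ-enumℚ : ∀ n → indexℚ (enumℚ n) ≡ n
  indexℚ-enumℚ n = trans (cong rank (proj₂ (enum∈S n))) (rank-enum n)

module _ (P : Partition) (k : ℕ) (Ts : Fin (suc k) → TP) where
  open Partition P
  open Aut
  open Elem

  GElem-irrelevant : (g : GElem P k Ts) {q q′ : QK P (suc k)} → proj₁ q ≡ proj₁ q′ →
                     ∀ i e e′ → _≈A_ P (g q i e) (g q′ i e′)
  GElem-irrelevant g {a , p} {.a , p′} refl i e e′
    rewrite ℕ.≤-irrelevant p p′ | ℕ.≡-irrelevant e e′ = λ _ → refl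

  module Branch (i : Fin (suc k)) = Stratum P (suc (toℕ i)) (s≤s z≤n)

  enumQK : Fin (suc k) → ℕ → QK P (suc k)
  enumQK i n = Branch.enumℚ i n , subst (_≤ suc k) (sym (Branch.#-enumℚ i n)) (toℕ<n i)

  reindex : GElem P k Ts → RawGroup.Carrier (PowGroup P k Ts)
  reindex g n i = g (enumQK i n) i (Branch.#-enumℚ i n)

  G≅Pow : GGroup P k Ts ≅ PowGroup P k Ts
  G≅Pow = reindex , record
    { isGroupMonomorphism = record
      { isGroupHomomorphism = record
        { isMonoidHomomorphism = record
          { isMagmaHomomorphism = record
            { isRelHomomorphism = record { cong = λ g≈g′ n i → g≈g′ _ i _ }
            ; homo = λ _ _ _ _ _ → refl }
          ; ε-homo = λ _ _ _ → refl }
        ; ⁻¹-homo = λ _ _ _ _ → refl }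
      ; injective = λ {g} {g′} → injective {g} {g′} }
    ; surjective = surjective }
    where
    injective : ∀ {g g′} → RawGroup._≈_ (PowGroup P k Ts) (reindex g) (reindex g′) → _≈G_ P k Ts g g′
    injective {g} {g′} g≈g′ q i e x = trans (GElem-irrelevant g (sym q≡) i e _ x)
      (trans (g≈g′ n i x) (GElem-irrelevant g′ q≡ i _ e x))
      where
      n = Branch.indexℚ i (proj₁ q)
      q≡ = Branch.enumℚ-indexℚ i e

    surjective : ∀ y → ∃ λ g → ∀ {g′} → _≈G_ P k Ts g′ g →
                 RawGroup._≈_ (PowGroup P k Ts) (reindex g′) y
    surjective y = (λ q i _ → y (Branch.indexℚ i (proj₁ q)) i) , λ g′≈g n i x →
      trans (g′≈g (enumQK i n) i _ x) (cong (λ n′ → seq (to (y n′ i) x)) (Branch.indexℚ-enumℚ i n))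

module Children (k : ℕ) (Ts : Fin (suc k) → TP) where

  childAt-toℕ : ∀ i → childAt k Ts (suc (toℕ i)) ≡ just (Ts i)
  childAt-toℕ i with toℕ i <? suc k
  ... | yes i<1+k = cong (λ j → just (Ts j)) (fromℕ<-toℕ i i<1+k)
  ... | no i≮1+k = contradiction (toℕ<n i) i≮1+k

  label-σ-child : ∀ i t → label (σ k Ts) (suc (toℕ i) ∷ t) ≡ label (Ts i) t
  label-σ-child i t rewrite childAt-toℕ i = refl

  label-s-child : ∀ i t → label (s k Ts) (suc (toℕ i) ∷ t) ≡ label (Ts i) t
  label-s-child i t rewrite childAt-toℕ i = refl

  label-σ-child⁻¹ : ∀ j t {l} → label (σ k Ts) (j ∷ t) ≡ just l →
                    ∃ λ i → j ≡ suc (toℕ i) × label (Ts i) t ≡ just l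
  label-σ-child⁻¹ zero t ()
  label-σ-child⁻¹ (suc j) t eq with j <? suc k
  ... | yes j<1+k = fromℕ< j<1+k , cong suc (sym (toℕ-fromℕ< j<1+k)) , eq
  ... | no _ with eq
  ...   | ()

isNode-[] : ∀ T → IsNode T []
isNode-[] 𝟙 = _ , refl
isNode-[] (s _ _) = _ , refl
isNode-[] (σ _ _) = _ , refl

-- hd [] is junk; it never matters since elements of 𝓛_σ are nonempty
hd : List ℚ → ℚ
hd [] = 0ℚ
hd (q ∷ _) = q

tl : List ℚ → List ℚ
tl [] = []
tl (_ ∷ r) = r

module Shuffle (P : Partition) (k : ℕ) (Ts : Fin (suc k) → TP) where
  open Partition P
  open Children k Ts
  open Elem
  open Aut

  T : TP
  T = σ k Ts

  -- q ∈ℚ[ i ] says q ∈ ℚ_{i+1}: children of a node are numbered from 1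
  _∈ℚ[_] : ℚ → Fin (suc k) → Set
  q ∈ℚ[ i ] = # q ≡ suc (toℕ i)

  ∈ℚ-unique : ∀ {q q′ i i′} → q ≡ q′ → q ∈ℚ[ i ] → q′ ∈ℚ[ i′ ] → i ≡ i′
  ∈ℚ-unique refl e e′ = toℕ-injective (ℕ.suc-injective (trans (sym e) e′))

  isNode-∷ : ∀ i {t} → IsNode (Ts i) t → IsNode T (suc (toℕ i) ∷ t)
  isNode-∷ i (l , eq) = l , trans (label-σ-child i _) eq

  isNode-∷⁻¹ : ∀ {j t} → IsNode T (j ∷ t) → ∃ λ i → j ≡ suc (toℕ i) × IsNode (Ts i) t
  isNode-∷⁻¹ {j} {t} (l , eq) with label-σ-child⁻¹ j t eq
  ... | i , j≡ , eq′ = i , j≡ , l , eq′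

  label-∈ℚ : ∀ {q i} → q ∈ℚ[ i ] → ∀ t → label T (# q ∷ t) ≡ label (Ts i) t
  label-∈ℚ {i = i} e t = trans (cong (λ n → label T (n ∷ t)) e) (label-σ-child i t)

  -- abstract, so that membership proofs are never unfolded when elements of 𝓛_T are compared
  abstract
    InL-∷ : ∀ {q i r} → q ∈ℚ[ i ] → InL P (Ts i) r → InL P T (q ∷ r)
    InL-∷ e (leaf , sums) = trans (label-∈ℚ e _) leaf ,
      λ { fzero () ; (fsuc j) isSum → sums j (trans (sym (label-∈ℚ e _)) isSum) }

    InL-∷⁻¹ : ∀ {q i r} → q ∈ℚ[ i ] → InL P T (q ∷ r) → InL P (Ts i) r
    InL-∷⁻¹ e (leaf , sums) = trans (sym (label-∈ℚ e _)) leaf ,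
      λ j isSum → sums (fsuc j) (trans (label-∈ℚ e _) isSum)

    InL-branch : ∀ {q r} → InL P T (q ∷ r) → ∃ λ i → q ∈ℚ[ i ]
    InL-branch {q} {r} (leaf , _) with label-σ-child⁻¹ (# q) (#̄ P r) leaf
    ... | i , e , _ = i , e

    InL-∷-view : ∀ {x} → InL P T x → x ≡ hd x ∷ tl x
    InL-∷-view {[]} (() , _)
    InL-∷-view {_ ∷ _} _ = refl

  cons : ∀ q i → q ∈ℚ[ i ] → Elem P (Ts i) → Elem P T
  cons q i e r = elem (q ∷ seq r) (InL-∷ e (inL r))

  head : Elem P T → ℚ
  head x = hd (seq x)

  abstract
    seq-∷ : ∀ x → seq x ≡ head x ∷ tl (seq x)
    seq-∷ x = InL-∷-view (inL x)

    inL-∷ : ∀ x → InL P T (head x ∷ tl (seq x))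
    inL-∷ x = subst (InL P T) (seq-∷ x) (inL x)

    branch : Elem P T → Fin (suc k)
    branch x = proj₁ (InL-branch (inL-∷ x))

    head∈branch : ∀ x → head x ∈ℚ[ branch x ]
    head∈branch x = proj₂ (InL-branch (inL-∷ x))

  tail : ∀ x i → head x ∈ℚ[ i ] → Elem P (Ts i)
  tail x i e = elem (tl (seq x)) (InL-∷⁻¹ e (inL-∷ x))

  rest : ∀ x → Elem P (Ts (branch x))
  rest x = tail x (branch x) (head∈branch x)

  headQK : Elem P T → QK P (suc k)
  headQK x = head x , subst (_≤ suc k) (sym (head∈branch x)) (toℕ<n (branch x))

  -- E P t x y unfolds to Eseq t (seq x) (seq y)
  Eseq : List ℕ → List ℚ → List ℚ → Set
  Eseq t a b = (t ⊑ #̄ P a) × (t ⊑ #̄ P b) × (take (length t) a ≡ take (length t) b)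

  Eseq-∷⁻¹ : ∀ {j t q r q′ r′} → Eseq (j ∷ t) (q ∷ r) (q′ ∷ r′) → j ≡ # q × q ≡ q′ × Eseq t r r′
  Eseq-∷⁻¹ (∷⊑ d , d′ , eq) = refl , proj₁ (∷-injective eq) , d , ⊑-tail d′ , proj₂ (∷-injective eq)
    where
    ⊑-tail : ∀ {a b u v} → (a ∷ u) ⊑ (b ∷ v) → u ⊑ v
    ⊑-tail (∷⊑ u⊑v) = u⊑v

  Eseq-∷ : ∀ {t q r q′ r′} → q ≡ q′ → Eseq t r r′ → Eseq (# q ∷ t) (q ∷ r) (q′ ∷ r′)
  Eseq-∷ refl (d , d′ , eq) = ∷⊑ d , ∷⊑ d′ , cong (_ ∷_) eq

  E-∷⁻¹ : ∀ {j t} x y → E P (j ∷ t) x y →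
          j ≡ # (head x) × head x ≡ head y × Eseq t (tl (seq x)) (tl (seq y))
  E-∷⁻¹ x y = Eseq-∷⁻¹ ∘ subst₂ (Eseq _) (seq-∷ x) (seq-∷ y)

  E-∷ : ∀ {t} x y → head x ≡ head y → Eseq t (tl (seq x)) (tl (seq y)) → E P (# (head x) ∷ t) x y
  E-∷ x y eq h = subst₂ (Eseq _) (sym (seq-∷ x)) (sym (seq-∷ y)) (Eseq-∷ eq h)

  <lex-∷⁻¹ : ∀ {q r q′ r′} → (q ∷ r) <lex (q′ ∷ r′) → q <ℚ q′ ⊎ (q ≡ q′ × r <lex r′)
  <lex-∷⁻¹ (head< q<q′) = inj₁ q<q′
  <lex-∷⁻¹ (tail< q≡q′ r<r′) = inj₂ (q≡q′ , r<r′)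

  <lex-head⁻¹ : ∀ x y → seq x <lex seq y →
                head x <ℚ head y ⊎ (head x ≡ head y × tl (seq x) <lex tl (seq y))
  <lex-head⁻¹ x y = <lex-∷⁻¹ ∘ subst₂ _<lex_ (seq-∷ x) (seq-∷ y)

  isNode-head : ∀ x → IsNode T (# (head x) ∷ [])
  isNode-head x =
    subst (λ n → IsNode T (n ∷ [])) (sym (head∈branch x)) (isNode-∷ (branch x) (isNode-[] (Ts (branch x))))

  -- automorphisms preserve E_⟨n⟩ for n = #(head x), and x E_⟨n⟩ y just says x, y have the same head
  head-to : (f : Aut P T) → ∀ {x y} → head x ≡ head y →
            # (head x) ≡ # (head (to f x)) × head (to f x) ≡ head (to f y)
  head-to f {x} {y} eq
    with E-∷⁻¹ (to f x) (to f y) (to-E f _ (isNode-head x) (E-∷ x y eq ([]⊑ , []⊑ , refl)))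
  ... | n≡ , heq , _ = n≡ , heq

  head-to-cong : (f : Aut P T) → ∀ {x y} → head x ≡ head y → head (to f x) ≡ head (to f y)
  head-to-cong f eq = proj₂ (head-to f eq)

  #-head-to : (f : Aut P T) → ∀ x → # (head (to f x)) ≡ # (head x)
  #-head-to f x = sym (proj₁ (head-to f {x} {x} refl))

  head-to-injective : (f : Aut P T) → ∀ {x y} → head (to f x) ≡ head (to f y) → head x ≡ head y
  head-to-injective f {x} {y} eq =
    trans (cong hd (sym (from-to f x))) (trans (head-to-cong (invA P f) eq) (cong hd (from-to f y)))

  head-to-from : (f : Aut P T) → ∀ {z w} → head z ≡ head (from f w) → head (to f z) ≡ head w
  head-to-from f {z} {w} eq = trans (head-to-cong f eq) (cong hd (to-from f w))

module _ (P : Partition) where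
  open Partition P
  open Elem

  #-one : # (ℕ→ℚ 1) ≡ 1
  #-one = #-self 1 (s≤s z≤n)

  inhabitant : (T : TP) → Elem P T
  inhabitant 𝟙 = elem [] (refl , λ ())
  inhabitant (σ k Ts) = Shuffle.cons P k Ts (ℕ→ℚ 1) fzero #-one (inhabitant (Ts fzero))
  inhabitant (s k Ts) = elem (ℕ→ℚ 1 ∷ seq r) (trans (label-one _) (proj₁ (inL r)) , sums)
    where
    open Children k Ts
    r = inhabitant (Ts fzero)
    label-one : ∀ t → label (s k Ts) (# (ℕ→ℚ 1) ∷ t) ≡ label (Ts fzero) t
    label-one t = trans (cong (λ n → label (s k Ts) (n ∷ t)) #-one) (label-s-child fzero t)
    sums : ∀ j → label (s k Ts) (take (toℕ j) (#̄ P (ℕ→ℚ 1 ∷ seq r))) ≡ just s-sum →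
           lookup (ℕ→ℚ 1 ∷ seq r) j ≡ ℕ→ℚ (# (lookup (ℕ→ℚ 1 ∷ seq r) j))
    sums fzero _ = cong ℕ→ℚ (sym #-one)
    sums (fsuc j) isSum = proj₂ (inL r) j (trans (sym (label-one _)) isSum)

module _ (P : Partition) {T : TP} where
  open Aut
  open Elem

  from-≈A : ∀ {f f′ : Aut P T} → _≈A_ P f f′ → ∀ y → seq (from f y) ≡ seq (from f′ y)
  from-≈A {f} {f′} f≈f′ y = begin
    seq (from f y)                  ≡⟨ from-cong f (sym (to-from f′ y)) ⟩
    seq (from f (to f′ (from f′ y))) ≡⟨ from-cong f (sym (f≈f′ (from f′ y))) ⟩
    seq (from f (to f (from f′ y)))  ≡⟨ from-to f (from f′ y) ⟩
    seq (from f′ y)                  ∎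
    where open ≡-Reasoning

module ShuffleAut (P : Partition) (k : ℕ) (Ts : Fin (suc k) → TP) where
  open Partition P
  open Shuffle P k Ts
  open Elem
  open Aut

  index-of : ∀ {n} → 1 ≤ n → n ≤ suc k → ∃ λ (i : Fin (suc k)) → n ≡ suc (toℕ i)
  index-of {suc n} _ n<1+k = fromℕ< n<1+k , cong suc (sym (toℕ-fromℕ< n<1+k))

  atom : QK P (suc k) → Elem P T
  atom (q , #q≤1+k) with index-of (#-pos q) #q≤1+k
  ... | i , e = cons q i e (inhabitant P (Ts i))

  GElem-apply-cong : (g : GElem P k Ts) → ∀ {q q′} → proj₁ q ≡ proj₁ q′ →
                     ∀ {i i′ e e′} {r : Elem P (Ts i)} {r′ : Elem P (Ts i′)} →
                     seq r ≡ seq r′ → seq (to (g q i e) r) ≡ seq (to (g q′ i′ e′) r′)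
  GElem-apply-cong g q≡q′ {i} {e = e} {e′} {r′ = r′} r≡r′ with ∈ℚ-unique q≡q′ e e′
  ... | refl = trans (to-cong (g _ i e) r≡r′) (GElem-irrelevant P k Ts g q≡q′ i e e′ r′)

  headMap : Aut P T → QK P (suc k) → QK P (suc k)
  headMap f q = head (to f (atom q)) , subst (_≤ suc k) (sym (#-head-to f (atom q))) (proj₂ q)

  headMap-< : (f : Aut P T) → ∀ {q q′} → proj₁ q <ℚ proj₁ q′ →
              proj₁ (headMap f q) <ℚ proj₁ (headMap f q′)
  headMap-< f {q} {q′} q<q′ with <lex-head⁻¹ (to f (atom q)) (to f (atom q′)) (to-< f (head< q<q′))
  ... | inj₁ fq<fq′ = fq<fq′
  ... | inj₂ (fq≡fq′ , _) = contradiction (head-to-injective f fq≡fq′) (ℚ.<⇒≢ q<q′)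

  toH : Aut P T → H P (suc k)
  toH f = record
    { to = headMap f ; from = headMap (invA P f)
    ; to-cong = head-to-cong f ; from-cong = head-to-cong (invA P f)
    ; to-from = λ q → head-to-from f refl ; from-to = λ q → head-to-from (invA P f) refl
    ; to-< = headMap-< f ; from-< = headMap-< (invA P f)
    ; to-# = λ q → #-head-to f (atom q) ; from-# = λ q → #-head-to (invA P f) (atom q)
    }

  MapsHead : Aut P T → ℚ → ℚ → Set
  MapsHead f q p = ∀ z → head z ≡ q → head (to f z) ≡ p

  fibreMap : Aut P T → ∀ q i → q ∈ℚ[ i ] → Elem P (Ts i) → Elem P (Ts i)
  fibreMap f q i e r = tail (to f (cons q i e r)) i (trans (#-head-to f _) e)

  seq-to-cons : ∀ f {q p i} (e : q ∈ℚ[ i ]) → MapsHead f q p → ∀ r →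
                seq (to f (cons q i e r)) ≡ p ∷ seq (fibreMap f q i e r)
  seq-to-cons f e q↦p r = trans (seq-∷ y) (cong (_∷ tl (seq y)) (q↦p _ refl))
    where y = to f (cons _ _ e r)

  fibreMap-cong : ∀ {f f′} → _≈A_ P f f′ → ∀ {q q′ i e e′} {r r′ : Elem P (Ts i)} →
                  q ≡ q′ → seq r ≡ seq r′ →
                  seq (fibreMap f q i e r) ≡ seq (fibreMap f′ q′ i e′ r′)
  fibreMap-cong {f} f≈f′ q≡q′ r≡r′ = cong tl (trans (to-cong f (cong₂ _∷_ q≡q′ r≡r′)) (f≈f′ _))

  fibreMap-∘ : ∀ f₁ f₂ {q q′ i} (e : q ∈ℚ[ i ]) (e′ : q′ ∈ℚ[ i ]) → MapsHead f₂ q q′ → ∀ r →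
               seq (fibreMap (_∘A_ P f₁ f₂) q i e r) ≡ seq (fibreMap f₁ q′ i e′ (fibreMap f₂ q i e r))
  fibreMap-∘ f₁ f₂ e e′ q↦q′ r = cong tl (to-cong f₁ (seq-to-cons f₂ e q↦q′ r))

  fibreMap-inverse : ∀ f {q p i} (e : q ∈ℚ[ i ]) (e′ : p ∈ℚ[ i ]) → MapsHead f q p → ∀ r →
                     seq (fibreMap (invA P f) p i e′ (fibreMap f q i e r)) ≡ seq r
  fibreMap-inverse f e e′ q↦p r =
    cong tl (trans (from-cong f (sym (seq-to-cons f e q↦p r))) (from-to f (cons _ _ e r)))

  fibreMap-< : ∀ f {q i} (e : q ∈ℚ[ i ]) {r r′} →
               seq r <lex seq r′ → seq (fibreMap f q i e r) <lex seq (fibreMap f q i e r′)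
  fibreMap-< f e {r} {r′} r<r′
    with <lex-head⁻¹ (to f (cons _ _ e r)) (to f (cons _ _ e r′)) (to-< f (tail< refl r<r′))
  ... | inj₁ heads< = contradiction (head-to-cong f refl) (ℚ.<⇒≢ heads<)
  ... | inj₂ (_ , tails<) = tails<

  fibreMap-E : ∀ f {q i} (e : q ∈ℚ[ i ]) t → IsNode (Ts i) t → ∀ {r r′} →
               E P t r r′ → E P t (fibreMap f q i e r) (fibreMap f q i e r′)
  fibreMap-E f {q} {i} e t node {r} {r′} rEr′ =
    proj₂ (proj₂ (E-∷⁻¹ (to f (cons _ _ e r)) (to f (cons _ _ e r′))
                        (to-E f _ node′ (Eseq-∷ refl rEr′))))
    where
    node′ : IsNode T (# q ∷ t)
    node′ = subst (λ n → IsNode T (n ∷ t)) (sym e) (isNode-∷ i node)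

  fibre : ∀ f {q p i} (e : q ∈ℚ[ i ]) (e′ : p ∈ℚ[ i ]) →
          MapsHead f q p → MapsHead (invA P f) p q → Aut P (Ts i)
  fibre f e e′ q↦p p↦q = record
    { to = fibreMap f _ _ e ; from = fibreMap (invA P f) _ _ e′
    ; to-cong = fibreMap-cong {f} {f} (λ _ → refl) {e = e} {e} refl
    ; from-cong = fibreMap-cong {invA P f} {invA P f} (λ _ → refl) {e = e′} {e′} refl
    ; to-from = fibreMap-inverse (invA P f) e′ e p↦q
    ; from-to = fibreMap-inverse f e e′ q↦p
    ; to-< = fibreMap-< f e ; from-< = fibreMap-< (invA P f) e′
    ; to-E = fibreMap-E f e ; from-E = fibreMap-E (invA P f) e′
    }

  toG : Aut P T → GElem P k Ts
  toG f p i e = fibre f (trans (#-head-to (invA P f) (atom p)) e) e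
                  (λ _ → head-to-from f) (λ _ → head-to-cong (invA P f))

  toSemidirect : Aut P T → RawGroup.Carrier (SemidirectGroup P k Ts)
  toSemidirect f = toG f , toH f

  -- q ∷ r ↦ h q ∷ g_q r, with g indexed by the first entry before h is applied
  module Action (h : H P (suc k)) (g : GElem P k Ts) where
    private module h = H h

    fibreAt : ∀ x → Aut P (Ts (branch x))
    fibreAt x = g (headQK x) (branch x) (head∈branch x)

    act : Elem P T → Elem P T
    act x = cons (proj₁ (h.to (headQK x))) (branch x) (trans (h.to-# (headQK x)) (head∈branch x))
                 (to (fibreAt x) (rest x))

    apply-fibreAt : ∀ {x y i} (ex : head x ∈ℚ[ i ]) (ey : head y ∈ℚ[ i ]) → head x ≡ head y →
                    seq (to (g (headQK x) i ex) (tail y i ey)) ≡ seq (to (fibreAt y) (rest y))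
    apply-fibreAt {x} {y} {i} ex ey hx≡hy =
      GElem-apply-cong g {headQK x} {headQK y} hx≡hy {i} {branch y} {ex} {head∈branch y}
                       {tail y i ey} {rest y} refl

    act-cong : ∀ {x y} → seq x ≡ seq y → seq (act x) ≡ seq (act y)
    act-cong {x} {y} x≡y = cong₂ _∷_ (h.to-cong (cong hd x≡y))
      (GElem-apply-cong g {headQK x} {headQK y} (cong hd x≡y) {branch x} {branch y}
                        {head∈branch x} {head∈branch y} {rest x} {rest y} (cong tl x≡y))

    act-< : ∀ {x y} → seq x <lex seq y → seq (act x) <lex seq (act y)
    act-< {x} {y} x<y with <lex-head⁻¹ x y x<y
    ... | inj₁ hx<hy = head< (h.to-< hx<hy)
    ... | inj₂ (hx≡hy , tx<ty) = tail< (h.to-cong hx≡hy)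
      (subst (seq (to (fibreAt x) (rest x)) <lex_) (apply-fibreAt (head∈branch x) ey hx≡hy)
             (to-< (fibreAt x) {rest x} {tail y (branch x) ey} tx<ty))
      where
      ey : head y ∈ℚ[ branch x ]
      ey = trans (cong # (sym hx≡hy)) (head∈branch x)

    act-E : ∀ t → IsNode T t → ∀ {x y} → E P t x y → E P t (act x) (act y)
    act-E [] _ _ = []⊑ , []⊑ , refl
    act-E (j ∷ t) node {x} {y} xEy with isNode-∷⁻¹ node | E-∷⁻¹ x y xEy
    ... | i , j≡ , node′ | j≡#hx , hx≡hy , txEty =
      subst (λ n → E P (n ∷ t) (act x) (act y)) (trans (h.to-# (headQK x)) (sym j≡#hx))
        (E-∷ (act x) (act y) (h.to-cong hx≡hy)
          (subst₂ (Eseq t) (apply-fibreAt ex ex refl) (apply-fibreAt ex ey hx≡hy)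
            (to-E (g (headQK x) i ex) t node′ {tail x i ex} {tail y i ey} txEty)))
      where
      ex : head x ∈ℚ[ i ]
      ex = trans (sym j≡#hx) j≡
      ey : head y ∈ℚ[ i ]
      ey = trans (cong # (sym hx≡hy)) ex

  -- (g , h) acts by q ∷ r ↦ h q ∷ g_{h q} r, and its inverse by h⁻¹ with the fibre maps g⁻¹
  fromSemidirect : GElem P k Ts → H P (suc k) → Aut P T
  fromSemidirect g h = record
    { to = F.act ; from = F⁻¹.act
    ; to-cong = F.act-cong ; from-cong = F⁻¹.act-cong
    ; to-from = to-from′ ; from-to = from-to′
    ; to-< = F.act-< ; from-< = F⁻¹.act-<
    ; to-E = F.act-E ; from-E = F⁻¹.act-E
    }
    where
    module h = H h
    module F = Action h (_▹_ P k Ts (invH P h) g)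
    module F⁻¹ = Action (invH P h) (invG P k Ts g)

    to-from′ : ∀ y → seq (F.act (F⁻¹.act y)) ≡ seq y
    to-from′ y = trans (cong₂ _∷_ hd≡ tl≡) (sym (seq-∷ y))
      where
      w = F⁻¹.act y
      hd≡ : proj₁ (h.to (headQK w)) ≡ head y
      hd≡ = trans (h.to-cong {headQK w} {h.from (headQK y)} refl) (h.to-from (headQK y))
      tl≡ : seq (to (F.fibreAt w) (rest w)) ≡ tl (seq y)
      tl≡ = trans (GElem-apply-cong g {h.to (headQK w)} {headQK y} hd≡ {branch w} {branch y}
                                    {trans (h.to-# (headQK w)) (head∈branch w)} {head∈branch y}
                                    {rest w} {to (F⁻¹.fibreAt y) (rest y)} refl)
                  (to-from (g (headQK y) (branch y) (head∈branch y)) (rest y))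

    from-to′ : ∀ x → seq (F⁻¹.act (F.act x)) ≡ seq x
    from-to′ x = trans (cong₂ _∷_ hd≡ tl≡) (sym (seq-∷ x))
      where
      w = F.act x
      hd≡ : proj₁ (h.from (headQK w)) ≡ head x
      hd≡ = trans (h.from-cong {headQK w} {h.to (headQK x)} refl) (h.from-to (headQK x))
      tl≡ : seq (to (F⁻¹.fibreAt w) (rest w)) ≡ tl (seq x)
      tl≡ = trans (GElem-apply-cong (invG P k Ts g) {headQK w} {h.to (headQK x)} refl {branch w} {branch x}
                                    {head∈branch w} {trans (h.to-# (headQK x)) (head∈branch x)}
                                    {rest w} {to (F.fibreAt x) (rest x)} refl)
                  (from-to (F.fibreAt x) (rest x))

  private
    SD = SemidirectGroup P k Ts
    open RawGroup SD using () renaming (_≈_ to _≈S_; _∙_ to _∙S_)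

  ≈S-trans : ∀ {x y z} → x ≈S y → y ≈S z → x ≈S z
  ≈S-trans (g≈g′ , h≈h′) (g′≈g″ , h′≈h″) =
    (λ p i e r → trans (g≈g′ p i e r) (g′≈g″ p i e r)) , (λ q → trans (h≈h′ q) (h′≈h″ q))

  fromSemidirect-toSemidirect : ∀ f → _≈A_ P (fromSemidirect (toG f) (toH f)) f
  fromSemidirect-toSemidirect f x =
    sym (trans (seq-∷ (to f x)) (cong₂ _∷_ (head-to-cong f refl) (cong tl (to-cong f x≡))))
    where
    q₀ = head (from f (atom (headMap f (headQK x))))
    q₀≡hx : q₀ ≡ head x
    q₀≡hx = head-to-from (invA P f) refl
    x≡ : seq x ≡ seq (cons q₀ (branch x) (trans (cong # q₀≡hx) (head∈branch x)) (rest x))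
    x≡ = trans (seq-∷ x) (cong (_∷ tl (seq x)) (sym q₀≡hx))

  fromSemidirect-cong : ∀ {g g′ h h′} → (g , h) ≈S (g′ , h′) →
                        _≈A_ P (fromSemidirect g h) (fromSemidirect g′ h′)
  fromSemidirect-cong {g} {g′} {h} {h′} (g≈g′ , h≈h′) x = cong₂ _∷_ (h≈h′ qx)
    (trans (g≈g′ (H.to h qx) (branch x) _ (rest x))
           (GElem-apply-cong g′ {H.to h qx} {H.to h′ qx} (h≈h′ qx) {branch x} {branch x}
                             {trans (H.to-# h qx) (head∈branch x)} {trans (H.to-# h′ qx) (head∈branch x)}
                             {rest x} {rest x} refl))
    where qx = headQK x

  toSemidirect-fromSemidirect : ∀ g h → toSemidirect (fromSemidirect g h) ≈S (g , h)
  toSemidirect-fromSemidirect g h = g-part , λ q → H.to-cong h refl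
    where
    g-part : _≈G_ P k Ts (toG (fromSemidirect g h)) g
    g-part p i e r = GElem-apply-cong g {H.to h (headQK c)} {p} hq {branch c} {i} {_} {e} {rest c} {r} refl
      where
      c = cons (head (from (fromSemidirect g h) (atom p))) i
               (trans (#-head-to (invA P (fromSemidirect g h)) (atom p)) e) r
      hq : proj₁ (H.to h (headQK c)) ≡ proj₁ p
      hq = trans (H.to-cong h {headQK c} {H.from h (headQK (atom p))} refl) (H.to-from h (headQK (atom p)))

  toSemidirect-cong : ∀ {f f′} → _≈A_ P f f′ → toSemidirect f ≈S toSemidirect f′
  toSemidirect-cong {f} {f′} f≈f′ =
    (λ p i e r → fibreMap-cong {f} {f′} f≈f′ (cong hd (from-≈A P {f = f} {f′} f≈f′ (atom p))) refl) ,
    (λ q → cong hd (f≈f′ (atom q)))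

  toSemidirect-∘ : ∀ f₁ f₂ → toSemidirect (_∘A_ P f₁ f₂) ≈S (toSemidirect f₁ ∙S toSemidirect f₂)
  toSemidirect-∘ f₁ f₂ = g-part , λ q → head-to-cong f₁ refl
    where
    g-part : _≈G_ P k Ts (toG (_∘A_ P f₁ f₂)) (_·G_ P k Ts (toG f₁) (_▹_ P k Ts (toH f₁) (toG f₂)))
    g-part p i e r = trans (fibreMap-cong {f₁∘f₂} {f₁∘f₂} (λ _ → refl)
                                          (head-to-cong (invA P f₂) refl) refl)
                           (fibreMap-∘ f₁ f₂ _ _ (λ _ → head-to-from f₂) r)
      where f₁∘f₂ = _∘A_ P f₁ f₂

  toSemidirect-idA : toSemidirect (idA P) ≈S (1G P k Ts , idH P)
  toSemidirect-idA = (λ _ _ _ _ → refl) , (λ _ → refl)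

  toSemidirect-invA : ∀ f → toSemidirect (invA P f) ≈S RawGroup._⁻¹ SD (toSemidirect f)
  toSemidirect-invA f =
    (λ p i e r → fibreMap-cong {invA P f} {invA P f} (λ _ → refl) {e = e′ p e} {e′ p e} refl refl) ,
    (λ _ → refl)
    where
    e′ : ∀ p {i} → proj₁ p ∈ℚ[ i ] → head (to f (atom p)) ∈ℚ[ i ]
    e′ p e = trans (#-head-to f (atom p)) e

  toSemidirect-injective : ∀ {f f′} → toSemidirect f ≈S toSemidirect f′ → _≈A_ P f f′
  toSemidirect-injective {f} {f′} images≈ x = begin
    seq (to f x)                                   ≡⟨ fromSemidirect-toSemidirect f x ⟨
    seq (to (fromSemidirect (toG f) (toH f)) x)    ≡⟨ preimages≈ x ⟩
    seq (to (fromSemidirect (toG f′) (toH f′)) x)  ≡⟨ fromSemidirect-toSemidirect f′ x ⟩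
    seq (to f′ x)                                  ∎
    where
    open ≡-Reasoning
    preimages≈ : _≈A_ P (fromSemidirect (toG f) (toH f)) (fromSemidirect (toG f′) (toH f′))
    preimages≈ = fromSemidirect-cong {toG f} {toG f′} {toH f} {toH f′} images≈

  toSemidirect-surjective : ∀ gh → ∃ λ f → ∀ {f′} → _≈A_ P f′ f → toSemidirect f′ ≈S gh
  toSemidirect-surjective (g , h) = fromSemidirect g h ,
    λ {f′} f′≈f → ≈S-trans {toSemidirect f′} {toSemidirect (fromSemidirect g h)} {g , h}
                           (toSemidirect-cong {f′} {fromSemidirect g h} f′≈f)
                           (toSemidirect-fromSemidirect g h)

  Aut≅Semidirect : AutGroup P T ≅ SemidirectGroup P k Ts
  Aut≅Semidirect = toSemidirect , record
    { isGroupMonomorphism = record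
      { isGroupHomomorphism = record
        { isMonoidHomomorphism = record
          { isMagmaHomomorphism = record
            { isRelHomomorphism = record { cong = λ {f} {f′} → toSemidirect-cong {f} {f′} }
            ; homo = toSemidirect-∘ }
          ; ε-homo = toSemidirect-idA }
        ; ⁻¹-homo = toSemidirect-invA }
      ; injective = λ {f} {f′} → toSemidirect-injective {f} {f′} }
    ; surjective = toSemidirect-surjective }

lemma8 : (P : Partition) (k : ℕ) (Ts : Fin (suc k) → TP) →
         (AutGroup P (σ k Ts) ≅ SemidirectGroup P k Ts)
         × (GGroup P k Ts ≅ PowGroup P k Ts)
lemma8 P k Ts = ShuffleAut.Aut≅Semidirect P k Ts , G≅Pow P k Ts
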